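{- Let $a\ge b\ge 2$ be integers, $n=a+b+1$, and let $I=i_1\cdots i_z\in\mathcal W_>$. Then $D_I\ge i_1-2\ge 0$. If moreover $q\ge p+1$, then: (1) if $I\in\mathcal A$, then $i_1\ge 3$ and $D_I\ge 2i_1-3$; (2) if $I\in\mathcal W_>\setminus\mathcal A$, then $i_1\ge 4$ and $D_I\ge i_1+2$.
   Context: A composition $I=i_1\cdots i_z\vDash n$ is a sequence of positive integers with sum $n$; $\overline I=i_z\cdots i_1$; $|i_1\cdots i_k|=i_1+\dots+i_k$. $w_I=i_1(i_2-1)\cdots(i_z-1)$. $\Theta_I^+(x)=\min\{|i_1\cdots i_k|:0\le k\le z,\ |i_1\cdots i_k|\ge x\}-x$; $\Theta_I^-(x)=x-\max\{|i_1\cdots i_k|:0\le k\le z,\ |i_1\cdots i_k|\le x\}$. $e_2(x_1,\dots,x_m)=\sum_{i<j}x_ix_j$. Integers $p,s,q,t$ are defined by $b+1=i_1+\dots+i_{p-1}+s=i_2+\dots+i_q+t$, $1\le p,q\le z$, $1\le s\le i_p$, $1\le t\le i_{q+1}$, with $i_{z+1}=i_1$; $\Delta_I(b+1)=s(i_p-s-i_1)$ if $i_1\le i_p-s$, else $e_2(i_p-s,i_{p+1},\dots,i_q,t)$. $\varphi$: write $I=PQ$ with $Q$ the shortest suffix with $|Q|\ge a$; $\varphi(I)=I$ if $Q=I$, else $\varphi(I)=i_1\,\overline{P\backslash i_1}\,Q$ ($P\backslash i_1$ = $P$ without its first part). $D_I=\Theta_I^+(2)-\Theta^-_{\overline{\varphi(I)}}(a)+\Delta_I(b+1)$.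 $\mathcal A=\{I\vDash n: w_I>0,\ \Theta^+_{\overline I}(a)=0\}$. $\mathcal W$ is the set of compositions of $n$ with all parts $\ge 2$, and $\mathcal W_>=\{I\in\mathcal W:i_1>\Theta^-_{\overline I}(a)\}$. -}

module Defs where

open import Data.Nat using (ℕ; zero; suc; _+_; _*_; _∸_; _≤_; _<_; _≤?_; _⊓_; _⊔_)
open import Data.Nat.ListAction using (sum; product)
open import Data.List using (List; []; _∷_; _++_; map; take; drop; reverse; filter; scanl; upTo; length; foldr)
open import Data.List.Relation.Unary.All using (All)
open import Data.Product using (_×_)
open import Data.Integer using (ℤ; +_; _-_)
open import Relation.Binary.PropositionalEquality using (_≡_)
open import Relation.Nullary using (yes; no)

IsComposition : ℕ → List ℕ → Set
IsComposition n I = All (λ i → 1 ≤ i) I × sum I ≡ n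

rev : List ℕ → List ℕ
rev = reverse

-- 1-based access to parts: part I k = i_k  (0 if out of range; never used out of range)
part : List ℕ → ℕ → ℕ
part []       _             = 0
part (x ∷ xs) zero          = 0
part (x ∷ xs) (suc zero)    = x
part (x ∷ xs) (suc (suc k)) = part xs (suc k)

first : List ℕ → ℕ
first []      = 0
first (x ∷ _) = x

partCyc : List ℕ → ℕ → ℕ
partCyc I k with k Data.Nat.≟ suc (length I)
... | yes _ = first I
... | no  _ = part I k

partialSums : List ℕ → List ℕ
partialSums I = scanl _+_ 0 I

minL : List ℕ → ℕ
minL []       = 0
minL (x ∷ xs) = foldr _⊓_ x xs

maxL : List ℕ → ℕ
maxL = foldr _⊔_ 0

ΘPlus : List ℕ → ℕ → ℕ
ΘPlus I x = minL (filter (λ y → x ≤? y) (partialSums I)) ∸ x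

-- Θ^-_I(x) = x - max{ |i_1..i_k| ≤ x }   (0 = |∅| always belongs to this set)
ΘMinus : List ℕ → ℕ → ℕ
ΘMinus I x = x ∸ maxL (filter (λ y → y ≤? x) (partialSums I))

w : List ℕ → ℕ
w I = first I * product (map (λ i → i ∸ 1) (drop 1 I))

e₂ : List ℕ → ℕ
e₂ []       = 0
e₂ (x ∷ xs) = x * sum xs + e₂ xs

-- φ: I = P Q with Q the shortest suffix with |Q| ≥ a.
-- Q = drop k I where k is the largest k ≤ z with |drop k I| ≥ a; P = take k I.
splitIndex : ℕ → List ℕ → ℕ
splitIndex a I = maxL (filter (λ k → a ≤? sum (drop k I)) (upTo (suc (length I))))

φAux : List ℕ → ℕ → List ℕ
φAux I zero    = I
φAux I (suc k) = take 1 I ++ reverse (drop 1 (take (suc k) I)) ++ drop (suc k) I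
                                                    -- i_1 \overline{P \ i_1} Q

φ : ℕ → List ℕ → List ℕ
φ a I = φAux I (splitIndex a I)

IsPSQT : ℕ → List ℕ → ℕ → ℕ → ℕ → ℕ → Set
IsPSQT b I p s q t =
  (1 ≤ p × p ≤ length I × 1 ≤ s × s ≤ part I p × suc b ≡ sum (take (p ∸ 1) I) + s) ×
  (1 ≤ q × q ≤ length I × 1 ≤ t × t ≤ partCyc I (suc q) × suc b ≡ sum (take (q ∸ 1) (drop 1 I)) + t)

Δ : List ℕ → ℕ → ℕ → ℕ → ℕ → ℕ
Δ I p s q t with first I ≤? (part I p ∸ s)
... | yes _ = s * ((part I p ∸ s) ∸ first I)
... | no  _ = e₂ ((part I p ∸ s) ∷ (take (q ∸ p) (drop p I) ++ (t ∷ [])))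

D : ℕ → List ℕ → ℕ → ℕ → ℕ → ℕ → ℤ
D a I p s q t = (+ ΘPlus I 2 - + ΘMinus (rev (φ a I)) a) Data.Integer.+ + Δ I p s q t

InA : ℕ → ℕ → List ℕ → Set
InA n a I = IsComposition n I × 0 < w I × ΘPlus (rev I) a ≡ 0

InW : ℕ → List ℕ → Set
InW n I = IsComposition n I × All (λ i → 2 ≤ i) I

InW> : ℕ → ℕ → List ℕ → Set
InW> n a I = InW n I × ΘMinus (rev I) a < first I

module Submission where

-- Cut I at the part i_p that contains b+1 and put θ = i_p − s.  The part i_p ends at height
-- b+1+θ, so the suffix R after it has |R| = a − θ; hence Θ⁻ of the reversal of I at a is at
-- least θ, and θ < i_1 because I ∈ 𝒲_>.  In particular i_1 ≰ i_p − s, so Δ_I(b+1) is the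
-- e₂-value, which only decreases when the parts i_{p+1},…,i_q are merged into their sum M:
-- Δ ≥ e₂(θ, M, t).  The map φ only permutes the parts before R, so R is still a suffix of φ(I)
-- and Θ⁻ of its reversal at a is at most θ.  Since also Θ⁺_I(2) = i_1 − 2, D_I ≥ i_1 − 2 − θ
-- + e₂(θ, M, t).  When q > p, comparing the two expressions for b+1 gives i_1 = θ + M + t with
-- M ≥ 2 and t ≥ 1, and both bounds become polynomial inequalities in θ, M, t; outside 𝒜
-- necessarily θ ≥ 1, because θ = 0 makes a a partial sum of the reversal of I.

open import Defs
open import Data.Nat using (ℕ; zero; suc; _+_; _∸_; _≤_; _<_; _≤?_; _⊓_; z≤n; s≤s)
open import Data.Nat.Properties
open import Data.Nat.ListAction using (sum; product)
open import Data.Nat.ListAction.Properties using (sum-++; sum-↭)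
open import Data.List using (List; []; _∷_; _++_; [_]; map; take; drop; reverse; scanl; upTo; length; foldr)
open import Data.List.Properties using (reverse-++; ++-assoc; take++drop≡id; drop-drop; take-[]; filter-accept)
open import Data.List.Relation.Binary.Permutation.Propositional.Properties using (↭-reverse)
open import Data.List.Relation.Unary.All as All using (All; []; _∷_)
open import Data.List.Relation.Unary.All.Properties using (all-filter; filter⁺; drop⁺)
open import Data.List.Relation.Unary.Any using (here; there)
open import Data.List.Membership.Propositional using (_∈_)
open import Data.List.Membership.Propositional.Properties using (∈-filter⁺)
open import Data.Product using (_×_; _,_; ∃-syntax)
open import Data.Sum using (_⊎_; inj₁; inj₂)
open import Relation.Binary.PropositionalEquality using (_≡_; refl; sym; trans; cong; subst; subst₂; module ≡-Reasoning)
open import Relation.Nullary using (¬_; yes; no)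
open import Data.Empty using (⊥-elim)
open import Data.Nat.Tactic.RingSolver using (solve-∀)

sum-reverse : ∀ xs → sum (reverse xs) ≡ sum xs
sum-reverse xs = sum-↭ (↭-reverse xs)

sum-take+sum-drop : ∀ k xs → sum (take k xs) + sum (drop k xs) ≡ sum xs
sum-take+sum-drop k xs = trans (sym (sum-++ (take k xs) (drop k xs))) (cong sum (take++drop≡id k xs))

sum-drop≤sum : ∀ k xs → sum (drop k xs) ≤ sum xs
sum-drop≤sum k xs = ≤-trans (m≤n+m _ (sum (take k xs))) (≤-reflexive (sum-take+sum-drop k xs))

sum-take-+ : ∀ m n xs → sum (take (m + n) xs) ≡ sum (take m xs) + sum (take n (drop m xs))
sum-take-+ zero    n xs       = refl
sum-take-+ (suc m) n []       = sym (cong sum (take-[] n))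
sum-take-+ (suc m) n (x ∷ xs) = trans (cong (_+_ x) (sum-take-+ m n xs)) (sym (+-assoc x _ _))

sum-take-first : ∀ {q} xs → 1 ≤ q → sum (take q xs) ≡ first xs + sum (take (q ∸ 1) (drop 1 xs))
sum-take-first {suc q} []       _ = sym (cong sum (take-[] q))
sum-take-first {suc q} (x ∷ xs) _ = refl

drop-part : ∀ p xs → p < length xs → drop p xs ≡ part xs (suc p) ∷ drop (suc p) xs
drop-part zero    (x ∷ xs) _         = refl
drop-part (suc p) (x ∷ xs) (s≤s p<z) = drop-part p xs p<z

take-part-drop : ∀ p xs → p < length xs → xs ≡ take p xs ++ part xs (suc p) ∷ drop (suc p) xs
take-part-drop p xs p<z = trans (sym (take++drop≡id p xs)) (cong (take p xs ++_) (drop-part p xs p<z))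

sum-take-suc-part : ∀ p xs → p < length xs → sum (take (suc p) xs) ≡ sum (take p xs) + part xs (suc p)
sum-take-suc-part p xs p<z = begin
  sum (take (suc p) xs)                                 ≡⟨ cong (λ k → sum (take k xs)) (+-comm 1 p) ⟩
  sum (take (p + 1) xs)                                 ≡⟨ sum-take-+ p 1 xs ⟩
  sum (take p xs) + sum (take 1 (drop p xs))            ≡⟨ cong (λ ys → sum (take p xs) + sum (take 1 ys)) (drop-part p xs p<z) ⟩
  sum (take p xs) + (part xs (suc p) + 0)               ≡⟨ cong (_+_ (sum (take p xs))) (+-identityʳ _) ⟩
  sum (take p xs) + part xs (suc p)                     ∎
  where open ≡-Reasoning

sum-drop-< : ∀ {p k} xs → All (1 ≤_) xs → p < k → 0 < sum (drop k xs) → sum (drop k xs) < sum (drop p xs)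
sum-drop-< {zero}  {suc k} (x ∷ xs) (1≤x ∷ _)  _         _ = ≤-<-trans (sum-drop≤sum k xs) (m<n+m (sum xs) 1≤x)
sum-drop-< {suc p} {suc k} (x ∷ xs) (_ ∷ pos) (s≤s p<k) h = sum-drop-< xs pos p<k h

drop-suffix : ∀ {k p} (xs : List ℕ) → k ≤ p → drop k xs ≡ take (p ∸ k) (drop k xs) ++ drop p xs
drop-suffix {k} {p} xs k≤p = trans (sym (take++drop≡id (p ∸ k) (drop k xs)))
  (cong (take (p ∸ k) (drop k xs) ++_) (trans (drop-drop k (p ∸ k) xs) (cong (λ n → drop n xs) (m+[n∸m]≡n k≤p))))

minL-≤ : ∀ {y} xs → y ∈ xs → minL xs ≤ y
minL-≤ (x ∷ xs) = go xs
  where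
  go : ∀ {y} xs → y ∈ x ∷ xs → foldr _⊓_ x xs ≤ y
  go []       (here refl)         = ≤-refl
  go (z ∷ zs) (here refl)         = ≤-trans (m⊓n≤n z _) (go zs (here refl))
  go (z ∷ zs) (there (here refl)) = m⊓n≤m z _
  go (z ∷ zs) (there (there y∈))  = ≤-trans (m⊓n≤n z _) (go zs (there y∈))

≤-minL : ∀ {y x xs} → y ≤ x → All (y ≤_) xs → y ≤ minL (x ∷ xs)
≤-minL y≤x []           = y≤x
≤-minL y≤x (y≤z ∷ y≤zs) = ⊓-glb y≤z (≤-minL y≤x y≤zs)

≤-maxL : ∀ {y} xs → y ∈ xs → y ≤ maxL xs
≤-maxL (x ∷ xs) (here refl) = m≤m⊔n x _
≤-maxL (x ∷ xs) (there y∈)  = ≤-trans (≤-maxL xs y∈) (m≤n⊔m x _)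

maxL-≤ : ∀ {y xs} → All (_≤ y) xs → maxL xs ≤ y
maxL-≤ []             = z≤n
maxL-≤ (x≤y ∷ xs≤y) = ⊔-lub x≤y (maxL-≤ xs≤y)

scanl-≥ : ∀ c xs → All (c ≤_) (scanl _+_ c xs)
scanl-≥ c []       = ≤-refl ∷ []
scanl-≥ c (x ∷ xs) = ≤-refl ∷ All.map (≤-trans (m≤m+n c x)) (scanl-≥ (c + x) xs)

scanl-++-∈ : ∀ c xs ys → c + sum xs ∈ scanl _+_ c (xs ++ ys)
scanl-++-∈ c []       []       = here (+-identityʳ c)
scanl-++-∈ c []       (y ∷ ys) = here (+-identityʳ c)
scanl-++-∈ c (x ∷ xs) ys       =
  there (subst (_∈ scanl _+_ (c + x) (xs ++ ys)) (+-assoc c x (sum xs)) (scanl-++-∈ (c + x) xs ys))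

scanl-gap : ∀ c xs i ys →
  All (λ v → v ≤ c + sum xs ⊎ c + sum xs + i ≤ v) (scanl _+_ c (xs ++ i ∷ ys))
scanl-gap c []       i ys = inj₁ (m≤m+n c 0) ∷
  All.map (λ c+i≤v → inj₂ (≤-trans (≤-reflexive (cong (_+ i) (+-identityʳ c))) c+i≤v)) (scanl-≥ (c + i) ys)
scanl-gap c (x ∷ xs) i ys = inj₁ (m≤m+n c _) ∷
  subst (λ h → All (λ v → v ≤ h ⊎ h + i ≤ v) (scanl _+_ (c + x) (xs ++ i ∷ ys)))
        (+-assoc c x (sum xs)) (scanl-gap (c + x) xs i ys)

suffix-sum∈partialSums-reverse : ∀ xs ys → sum ys ∈ partialSums (reverse (xs ++ ys))
suffix-sum∈partialSums-reverse xs ys =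
  subst₂ (λ h zs → h ∈ scanl _+_ 0 zs) (sum-reverse ys) (sym (reverse-++ xs ys))
         (scanl-++-∈ 0 (reverse ys) (reverse xs))

partialSums-reverse-gap : ∀ xs i ys →
  All (λ v → v ≤ sum ys ⊎ sum ys + i ≤ v) (partialSums (reverse (xs ++ i ∷ ys)))
partialSums-reverse-gap xs i ys =
  subst₂ (λ h zs → All (λ v → v ≤ h ⊎ h + i ≤ v) (scanl _+_ 0 zs)) (sum-reverse ys) (sym rev≡)
         (scanl-gap 0 (reverse ys) i (reverse xs))
  where
  rev≡ : reverse (xs ++ i ∷ ys) ≡ reverse ys ++ i ∷ reverse xs
  rev≡ = begin
    reverse (xs ++ i ∷ ys)              ≡⟨ reverse-++ xs (i ∷ ys) ⟩
    reverse (i ∷ ys) ++ reverse xs      ≡⟨ cong (_++ reverse xs) (reverse-++ [ i ] ys) ⟩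
    (reverse ys ++ [ i ]) ++ reverse xs ≡⟨ ++-assoc (reverse ys) [ i ] (reverse xs) ⟩
    reverse ys ++ i ∷ reverse xs        ∎
    where open ≡-Reasoning

ΘMinus-≥ : ∀ {xs a y} → All (λ v → v ≤ a → v ≤ y) (partialSums xs) → a ∸ y ≤ ΘMinus xs a
ΘMinus-≥ {xs} {a} below = ∸-monoʳ-≤ a (maxL-≤ (All.map (λ (v≤a , f) → f v≤a)
  (All.zip (all-filter (_≤? a) (partialSums xs) , filter⁺ (_≤? a) below))))

ΘMinus-≤ : ∀ {xs a y} → y ∈ partialSums xs → y ≤ a → ΘMinus xs a ≤ a ∸ y
ΘMinus-≤ {a = a} y∈ y≤a = ∸-monoʳ-≤ a (≤-maxL _ (∈-filter⁺ (_≤? a) y∈ y≤a))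

ΘPlus-≡0 : ∀ {xs a} → a ∈ partialSums xs → ΘPlus xs a ≡ 0
ΘPlus-≡0 {a = a} a∈ = m≤n⇒m∸n≡0 (minL-≤ _ (∈-filter⁺ (a ≤?_) a∈ ≤-refl))

ΘPlus-head : ∀ {c x} xs → 1 ≤ c → c ≤ x → x ∸ c ≤ ΘPlus (x ∷ xs) c
ΘPlus-head {suc c} {x} xs _ c≤x = ∸-monoˡ-≤ (suc c)
  (subst (x ≤_) (cong minL (sym (filter-accept (suc c ≤?_) c≤x)))
         (≤-minL ≤-refl (filter⁺ (suc c ≤?_) (All.tail (scanl-≥ x xs)))))

ΘMinus-reverse-≥ : ∀ {a} xs i ys → a < i + sum ys → a ∸ sum ys ≤ ΘMinus (rev (xs ++ i ∷ ys)) a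
ΘMinus-reverse-≥ {a} xs i ys a<i+Σys = ΘMinus-≥ (All.map below (partialSums-reverse-gap xs i ys))
  where
  below : ∀ {v} → v ≤ sum ys ⊎ sum ys + i ≤ v → v ≤ a → v ≤ sum ys
  below (inj₁ v≤Σys) _   = v≤Σys
  below (inj₂ Σys+i≤v) v≤a =
    ⊥-elim (<⇒≱ a<i+Σys (≤-trans (≤-reflexive (+-comm i (sum ys))) (≤-trans Σys+i≤v v≤a)))

ΘMinus-reverse-≤ : ∀ {a} xs ys → sum ys ≤ a → ΘMinus (rev (xs ++ ys)) a ≤ a ∸ sum ys
ΘMinus-reverse-≤ xs ys = ΘMinus-≤ (suffix-sum∈partialSums-reverse xs ys)

ΘPlus-reverse-≡0 : ∀ {a} xs ys → sum ys ≡ a → ΘPlus (rev (xs ++ ys)) a ≡ 0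
ΘPlus-reverse-≡0 xs ys refl = ΘPlus-≡0 (suffix-sum∈partialSums-reverse xs ys)

splitIndex-≤ : ∀ {a p} I → 1 ≤ a → All (1 ≤_) I → sum (drop p I) ≤ a → splitIndex a I ≤ p
splitIndex-≤ {a} {p} I 1≤a pos Σ≤a =
  maxL-≤ (All.map ≤p (all-filter (λ k → a ≤? sum (drop k I)) (upTo (suc (length I)))))
  where
  ≤p : ∀ {k} → a ≤ sum (drop k I) → k ≤ p
  ≤p a≤Σ = ≮⇒≥ (λ p<k → <⇒≱ (sum-drop-< I pos p<k (≤-trans 1≤a a≤Σ)) (≤-trans Σ≤a a≤Σ))

φAux-suffix : ∀ {k p} I → k ≤ p → ∃[ xs ] φAux I k ≡ xs ++ drop p I
φAux-suffix {zero}  {p} I _ = take p I , sym (take++drop≡id p I)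
φAux-suffix {suc k} {p} I k<p = (A ++ B ++ C) , (begin
  A ++ B ++ drop (suc k) I          ≡⟨ cong (λ ys → A ++ B ++ ys) (drop-suffix I k<p) ⟩
  A ++ B ++ C ++ drop p I           ≡⟨ cong (A ++_) (++-assoc B C (drop p I)) ⟨
  A ++ (B ++ C) ++ drop p I         ≡⟨ ++-assoc A (B ++ C) (drop p I) ⟨
  (A ++ B ++ C) ++ drop p I         ∎)
  where
  open ≡-Reasoning
  A : List ℕ
  A = take 1 I
  B : List ℕ
  B = reverse (drop 1 (take (suc k) I))
  C : List ℕ
  C = take (p ∸ suc k) (drop (suc k) I)

φ-suffix : ∀ {a p} I → 1 ≤ a → All (1 ≤_) I → sum (drop p I) ≤ a → ∃[ xs ] φ a I ≡ xs ++ drop p I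
φ-suffix {p = p} I 1≤a pos Σ≤a = φAux-suffix I (splitIndex-≤ {p = p} I 1≤a pos Σ≤a)

module _ where
  open import Data.Nat using (_*_)

  e₂-merge-head : ∀ xs ys → e₂ (sum xs ∷ ys) ≤ e₂ (xs ++ ys)
  e₂-merge-head []       ys = ≤-refl
  e₂-merge-head (x ∷ xs) ys = begin
    (x + sum xs) * sum ys + e₂ ys           ≡⟨ cong (_+ e₂ ys) (*-distribʳ-+ (sum ys) x (sum xs)) ⟩
    x * sum ys + sum xs * sum ys + e₂ ys    ≡⟨ +-assoc (x * sum ys) _ _ ⟩
    x * sum ys + e₂ (sum xs ∷ ys)           ≤⟨ +-mono-≤ (*-monoʳ-≤ x Σys≤) (e₂-merge-head xs ys) ⟩
    x * sum (xs ++ ys) + e₂ (xs ++ ys)      ∎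
    where
    open ≤-Reasoning
    Σys≤ : sum ys ≤ sum (xs ++ ys)
    Σys≤ = ≤-trans (m≤n+m (sum ys) (sum xs)) (≤-reflexive (sym (sum-++ xs ys)))

  e₂-merge : ∀ ws xs ys → e₂ (ws ++ sum xs ∷ ys) ≤ e₂ (ws ++ xs ++ ys)
  e₂-merge []       xs ys = e₂-merge-head xs ys
  e₂-merge (w ∷ ws) xs ys = +-mono-≤ (≤-reflexive (cong (w *_) Σ≡)) (e₂-merge ws xs ys)
    where
    Σ≡ : sum (ws ++ sum xs ∷ ys) ≡ sum (ws ++ xs ++ ys)
    Σ≡ = trans (sum-++ ws _) (trans (cong (_+_ (sum ws)) (sym (sum-++ xs ys))) (sym (sum-++ ws (xs ++ ys))))

  e₂-triple : ∀ x y z → e₂ (x ∷ y ∷ z ∷ []) ≡ x * (y + z) + y * z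
  e₂-triple = unfolded
    where
    unfolded : ∀ x y z → x * (y + (z + 0)) + (y * (z + 0) + (z * 0 + 0)) ≡ x * (y + z) + y * z
    unfolded = solve-∀

  ≤-e₂-triple : ∀ θ M {t} → 1 ≤ t → θ ≤ e₂ (θ ∷ M ∷ t ∷ [])
  ≤-e₂-triple θ M {t} 1≤t = begin
    θ                          ≡⟨ *-identityʳ θ ⟨
    θ * 1                      ≤⟨ *-monoʳ-≤ θ (≤-trans 1≤t (m≤n+m t M)) ⟩
    θ * (M + t)                ≤⟨ m≤m+n _ _ ⟩
    θ * (M + t) + M * t        ≡⟨ e₂-triple θ M t ⟨
    e₂ (θ ∷ M ∷ t ∷ [])        ∎
    where open ≤-Reasoning

  e₂-triple-bound₁ : ∀ {x θ M t} → x ≡ θ + (M + t) → 2 ≤ M → 1 ≤ t →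
    2 * x ∸ 3 + θ ≤ x ∸ 2 + e₂ (θ ∷ M ∷ t ∷ [])
  e₂-triple-bound₁ {θ = θ} {suc (suc m)} {suc u} refl (s≤s (s≤s _)) _ = begin
    2 * x ∸ 3 + θ                                 ≡⟨ cong (λ n → n ∸ 3 + θ) (2x≡ θ m u) ⟩
    2 * θ + 2 * m + 2 * u + 3 + θ                 ≤⟨ m≤m+n _ (θ + θ * m + θ * u + u + m * u) ⟩
    2 * θ + 2 * m + 2 * u + 3 + θ + (θ + θ * m + θ * u + u + m * u)
                                                  ≡⟨ expand θ m u ⟩
    θ + m + suc u + (θ * (M + t) + M * t)         ≡⟨ cong (λ n → n ∸ 2 + (θ * (M + t) + M * t)) (x≡ θ m u) ⟩
    x ∸ 2 + (θ * (M + t) + M * t)                 ≡⟨ cong (_+_ (x ∸ 2)) (e₂-triple θ M t) ⟨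
    x ∸ 2 + e₂ (θ ∷ M ∷ t ∷ [])                   ∎
    where
    open ≤-Reasoning
    M : ℕ
    M = suc (suc m)
    t : ℕ
    t = suc u
    x : ℕ
    x = θ + (M + t)
    2x≡ : ∀ θ m u → 2 * (θ + (suc (suc m) + suc u)) ≡ 3 + (2 * θ + 2 * m + 2 * u + 3)
    2x≡ = solve-∀
    expand : ∀ θ m u → 2 * θ + 2 * m + 2 * u + 3 + θ + (θ + θ * m + θ * u + u + m * u) ≡
      θ + m + suc u + (θ * (suc (suc m) + suc u) + suc (suc m) * suc u)
    expand = solve-∀
    x≡ : ∀ θ m u → 2 + (θ + m + suc u) ≡ θ + (suc (suc m) + suc u)
    x≡ = solve-∀

  e₂-triple-bound₂ : ∀ {x θ M t} → x ≡ θ + (M + t) → 1 ≤ θ → 2 ≤ M → 1 ≤ t →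
    x + 2 + θ ≤ x ∸ 2 + e₂ (θ ∷ M ∷ t ∷ [])
  e₂-triple-bound₂ {θ = suc v} {suc (suc m)} {suc u} refl _ (s≤s (s≤s _)) _ = begin
    x + 2 + θ                                     ≤⟨ m≤m+n _ (2 * v + 2 * m + 3 * u + v * m + v * u + m * u) ⟩
    x + 2 + θ + (2 * v + 2 * m + 3 * u + v * m + v * u + m * u)
                                                  ≡⟨ expand v m u ⟩
    v + m + suc (suc u) + (θ * (M + t) + M * t)   ≡⟨ cong (λ n → n ∸ 2 + (θ * (M + t) + M * t)) (x≡ v m u) ⟩
    x ∸ 2 + (θ * (M + t) + M * t)                 ≡⟨ cong (_+_ (x ∸ 2)) (e₂-triple θ M t) ⟨
    x ∸ 2 + e₂ (θ ∷ M ∷ t ∷ [])                   ∎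
    where
    open ≤-Reasoning
    θ : ℕ
    θ = suc v
    M : ℕ
    M = suc (suc m)
    t : ℕ
    t = suc u
    x : ℕ
    x = θ + (M + t)
    expand : ∀ v m u → suc v + (suc (suc m) + suc u) + 2 + suc v + (2 * v + 2 * m + 3 * u + v * m + v * u + m * u) ≡
      v + m + suc (suc u) + (suc v * (suc (suc m) + suc u) + suc (suc m) * suc u)
    expand = solve-∀
    x≡ : ∀ v m u → 2 + (v + m + suc (suc u)) ≡ suc v + (suc (suc m) + suc u)
    x≡ = solve-∀

Δ-≥ : ∀ I p s q t → part I p ∸ s < first I →
  e₂ (part I p ∸ s ∷ sum (take (q ∸ p) (drop p I)) ∷ t ∷ []) ≤ Δ I p s q t
Δ-≥ I p s q t θ<i₁ with first I ≤? part I p ∸ s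
... | yes i₁≤θ = ⊥-elim (<⇒≱ θ<i₁ i₁≤θ)
... | no  _    = e₂-merge [ part I p ∸ s ] (take (q ∸ p) (drop p I)) [ t ]

product-pred-pos : ∀ {xs} → All (2 ≤_) xs → 0 < product (map (λ i → i ∸ 1) xs)
product-pred-pos []           = s≤s z≤n
product-pred-pos (2≤x ∷ 2≤xs) = *-mono-≤ (∸-monoˡ-≤ 1 2≤x) (product-pred-pos 2≤xs)

w-pos : ∀ {x xs} → 1 ≤ x → All (2 ≤_) xs → 0 < w (x ∷ xs)
w-pos 1≤x 2≤xs = *-mono-≤ 1≤x (product-pred-pos 2≤xs)

-- I = P · iₚ · R around the part containing b+1; this p is the paper's p − 1.
module Cut {a b p s q t : ℕ} {I : List ℕ} (ΣI : sum I ≡ a + b + 1)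
           (p<z : p < length I) (1≤s : 1 ≤ s) (s≤iₚ : s ≤ part I (suc p))
           (b+1≡ₚ : suc b ≡ sum (take p I) + s)
           (q≤z : q ≤ length I) (b+1≡q : suc b ≡ sum (take (q ∸ 1) (drop 1 I)) + t) where

  iₚ : ℕ
  iₚ = part I (suc p)

  θ : ℕ
  θ = iₚ ∸ s

  R : List ℕ
  R = drop (suc p) I

  M : ℕ
  M = sum (take (q ∸ suc p) R)

  private
    iₚ≡s+θ : iₚ ≡ s + θ
    iₚ≡s+θ = sym (m+[n∸m]≡n s≤iₚ)

    I≡ : I ≡ take p I ++ iₚ ∷ R
    I≡ = take-part-drop p I p<z

  θ+ΣR≡a : θ + sum R ≡ a
  θ+ΣR≡a = +-cancelˡ-≡ (suc b) _ _ (begin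
    suc b + (θ + sum R)                ≡⟨ cong (_+ (θ + sum R)) b+1≡ₚ ⟩
    sum (take p I) + s + (θ + sum R)   ≡⟨ regroup (sum (take p I)) s θ (sum R) ⟩
    sum (take p I) + (s + θ + sum R)   ≡⟨ cong (λ i → sum (take p I) + (i + sum R)) iₚ≡s+θ ⟨
    sum (take p I) + sum (iₚ ∷ R)      ≡⟨ sum-++ (take p I) (iₚ ∷ R) ⟨
    sum (take p I ++ iₚ ∷ R)           ≡⟨ cong sum I≡ ⟨
    sum I                              ≡⟨ ΣI ⟩
    a + b + 1                          ≡⟨ swap a b ⟩
    suc b + a                          ∎)
    where
    open ≡-Reasoning
    regroup : ∀ w x y z → w + x + (y + z) ≡ w + (x + y + z)
    regroup = solve-∀
    swap : ∀ a b → a + b + 1 ≡ suc b + a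
    swap = solve-∀

  private
    ΣR≤a : sum R ≤ a
    ΣR≤a = ≤-trans (m≤n+m (sum R) θ) (≤-reflexive θ+ΣR≡a)

    a∸ΣR≡θ : a ∸ sum R ≡ θ
    a∸ΣR≡θ = trans (cong (_∸ sum R) (sym θ+ΣR≡a)) (m+n∸n≡m θ (sum R))

  θ≤Θ⁻ : θ ≤ ΘMinus (rev I) a
  θ≤Θ⁻ = subst (λ J → θ ≤ ΘMinus (rev J) a) (sym I≡)
    (subst (_≤ ΘMinus (rev (take p I ++ iₚ ∷ R)) a) a∸ΣR≡θ (ΘMinus-reverse-≥ (take p I) iₚ R a<iₚ+ΣR))
    where
    a<iₚ+ΣR : a < iₚ + sum R
    a<iₚ+ΣR = begin-strict
      a                  ≡⟨ θ+ΣR≡a ⟨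
      θ + sum R          <⟨ m<n+m (θ + sum R) 1≤s ⟩
      s + (θ + sum R)    ≡⟨ +-assoc s θ (sum R) ⟨
      s + θ + sum R      ≡⟨ cong (_+ sum R) iₚ≡s+θ ⟨
      iₚ + sum R         ∎
      where open ≤-Reasoning

  Θ⁻φ≤θ : 1 ≤ a → All (1 ≤_) I → ΘMinus (rev (φ a I)) a ≤ θ
  Θ⁻φ≤θ 1≤a pos = let (P , φ≡) = φ-suffix {p = suc p} I 1≤a pos ΣR≤a in
    subst (λ J → ΘMinus (rev J) a ≤ θ) (sym φ≡) (≤-trans (ΘMinus-reverse-≤ P R ΣR≤a) (≤-reflexive a∸ΣR≡θ))

  θ≡0⇒Θ⁺≡0 : θ ≡ 0 → ΘPlus (rev I) a ≡ 0
  θ≡0⇒Θ⁺≡0 θ≡0 = subst (λ J → ΘPlus (rev J) a ≡ 0) (take++drop≡id (suc p) I)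
    (ΘPlus-reverse-≡0 (take (suc p) I) R (trans (cong (_+ sum R) (sym θ≡0)) θ+ΣR≡a))

  first≡θ+[M+t] : suc p < q → first I ≡ θ + (M + t)
  first≡θ+[M+t] p<q = +-cancelˡ-≡ (suc b) _ _ (begin
    suc b + first I                                          ≡⟨ +-comm (suc b) (first I) ⟩
    first I + suc b                                          ≡⟨ cong (_+_ (first I)) b+1≡q ⟩
    first I + (sum (take (q ∸ 1) (drop 1 I)) + t)            ≡⟨ +-assoc (first I) _ t ⟨
    first I + sum (take (q ∸ 1) (drop 1 I)) + t              ≡⟨ cong (_+ t) (sum-take-first I (≤-trans (s≤s z≤n) p<q)) ⟨
    sum (take q I) + t                                       ≡⟨ cong (λ n → sum (take n I) + t) (m+[n∸m]≡n (<⇒≤ p<q)) ⟨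
    sum (take (suc p + (q ∸ suc p)) I) + t                   ≡⟨ cong (_+ t) (sum-take-+ (suc p) (q ∸ suc p) I) ⟩
    sum (take (suc p) I) + M + t                             ≡⟨ cong (λ n → n + M + t) (sum-take-suc-part p I p<z) ⟩
    sum (take p I) + iₚ + M + t                              ≡⟨ cong (λ i → sum (take p I) + i + M + t) iₚ≡s+θ ⟩
    sum (take p I) + (s + θ) + M + t                         ≡⟨ regroup (sum (take p I)) s θ M t ⟩
    sum (take p I) + s + (θ + (M + t))                       ≡⟨ cong (_+ (θ + (M + t))) b+1≡ₚ ⟨
    suc b + (θ + (M + t))                                    ∎)
    where
    open ≡-Reasoning
    regroup : ∀ v w x y z → v + (w + x) + y + z ≡ v + w + (x + (y + z))
    regroup = solve-∀

  2≤M : All (2 ≤_) I → suc p < q → 2 ≤ M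
  2≤M 2≤I p<q = ≤-trans 2≤r (≤-trans (m≤m+n r _) (≤-reflexive (sym M≡)))
    where
    r : ℕ
    r = part I (suc (suc p))
    R≡ : R ≡ r ∷ drop (suc (suc p)) I
    R≡ = drop-part (suc p) I (<-≤-trans p<q q≤z)
    2≤r : 2 ≤ r
    2≤r = All.head (subst (All (2 ≤_)) R≡ (drop⁺ (suc p) 2≤I))
    M≡ : M ≡ r + sum (take (q ∸ suc p ∸ 1) (drop (suc (suc p)) I))
    M≡ = trans (cong (λ ys → sum (take (q ∸ suc p) ys)) R≡) (sum-take-first (r ∷ _) (m<n⇒0<n∸m p<q))

open import Data.Integer using (+_; _-_; _*_; +≤+) renaming (_≤_ to _≤ℤ_; _+_ to _+ℤ_)
import Data.Integer.Properties as ℤ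
import Data.Nat as ℕ using (_*_)
open import Data.Integer.Tactic.RingSolver using () renaming (solve-∀ to solveℤ-∀)

m-n≡m∸n : ∀ {m n} → n ≤ m → + m - + n ≡ + (m ∸ n)
m-n≡m∸n {m} {n} n≤m = trans (ℤ.m-n≡m⊖n m n) (ℤ.⊖-≥ n≤m)

c+v≤u+d⇒c≤u-v+d : ∀ {c u v d} → c + v ≤ u + d → + c ≤ℤ + u - + v +ℤ + d
c+v≤u+d⇒c≤u-v+d {c} {u} {v} {d} c+v≤u+d =
  ℤ.≤-trans (+≤+ (m+n≤o⇒m≤o∸n c c+v≤u+d))
            (ℤ.≤-reflexive (sym (trans (swap (+ u) (+ v) (+ d)) (m-n≡m∸n (≤-trans (m≤n+m v c) c+v≤u+d)))))
  where
  swap : ∀ i j k → i - j +ℤ k ≡ i +ℤ k - j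
  swap = solveℤ-∀

lemma4p4 : (a b : ℕ) → 2 ≤ b → b ≤ a → (I : List ℕ) → InW> (a + b + 1) a I →
    (p s q t : ℕ) → IsPSQT b I p s q t →
    ((+ first I - + 2 ≤ℤ D a I p s q t) × (+ 0 ≤ℤ + first I - + 2)) ×
    (suc p ≤ q →
      (InA (a + b + 1) a I → 3 ≤ first I × (+ 2 * + first I - + 3 ≤ℤ D a I p s q t)) ×
      (¬ InA (a + b + 1) a I → 4 ≤ first I × (+ first I +ℤ + 2 ≤ℤ D a I p s q t)))
lemma4p4 a b 2≤b b≤a []       _ zero    _ _ _ ((() , _) , _)
lemma4p4 a b 2≤b b≤a []       _ (suc _) _ _ _ ((_ , () , _) , _)
lemma4p4 a b 2≤b b≤a (x ∷ xs) _ zero    _ _ _ ((() , _) , _)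
lemma4p4 a b 2≤b b≤a I@(x ∷ xs) (((pos , ΣI) , 2≤I@(2≤x ∷ 2≤xs)) , Θ⁻<x) (suc p) s q t
  ((_ , p<z , 1≤s , s≤iₚ , b+1≡ₚ) , (_ , q≤z , 1≤t , _ , b+1≡q)) =
  (x-2≤D , 0≤x-2) , λ p<q → inA-bound p<q , notInA-bound p<q
  where
  open Cut {a = a} ΣI p<z 1≤s s≤iₚ b+1≡ₚ q≤z b+1≡q

  bound : ∀ {c} → c + θ ≤ x ∸ 2 + e₂ (θ ∷ M ∷ t ∷ []) → + c ≤ℤ D a I (suc p) s q t
  bound h = c+v≤u+d⇒c≤u-v+d (≤-trans (+-monoʳ-≤ _ (Θ⁻φ≤θ (≤-trans (s≤s z≤n) (≤-trans 2≤b b≤a)) pos))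
    (≤-trans h (+-mono-≤ (ΘPlus-head xs (s≤s z≤n) 2≤x) (Δ-≥ I (suc p) s q t (≤-<-trans θ≤Θ⁻ Θ⁻<x)))))

  x-2≤D : + x - + 2 ≤ℤ D a I (suc p) s q t
  x-2≤D = ℤ.≤-trans (ℤ.≤-reflexive (m-n≡m∸n 2≤x)) (bound (+-monoʳ-≤ (x ∸ 2) (≤-e₂-triple θ M 1≤t)))

  0≤x-2 : + 0 ≤ℤ + x - + 2
  0≤x-2 = ℤ.≤-trans (+≤+ z≤n) (ℤ.≤-reflexive (sym (m-n≡m∸n 2≤x)))

  3≤M+t : suc p < q → 3 ≤ M + t
  3≤M+t p<q = +-mono-≤ (2≤M 2≤I p<q) 1≤t

  inA-bound : suc p < q → InA (a + b + 1) a I → 3 ≤ x × (+ 2 * + x - + 3 ≤ℤ D a I (suc p) s q t)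
  inA-bound p<q _ = 3≤x , ℤ.≤-trans (ℤ.≤-reflexive 2x-3≡) (bound (e₂-triple-bound₁ x≡ (2≤M 2≤I p<q) 1≤t))
    where
    x≡ : x ≡ θ + (M + t)
    x≡ = first≡θ+[M+t] p<q
    3≤x : 3 ≤ x
    3≤x = ≤-trans (≤-trans (3≤M+t p<q) (m≤n+m _ θ)) (≤-reflexive (sym x≡))
    2x-3≡ : + 2 * + x - + 3 ≡ + (2 ℕ.* x ∸ 3)
    2x-3≡ = trans (cong (_- + 3) (sym (ℤ.pos-* 2 x))) (m-n≡m∸n (≤-trans 3≤x (m≤m+n x _)))

  notInA-bound : suc p < q → ¬ InA (a + b + 1) a I → 4 ≤ x × (+ x +ℤ + 2 ≤ℤ D a I (suc p) s q t)
  notInA-bound p<q ¬A = ≤-trans (+-mono-≤ 1≤θ (3≤M+t p<q)) (≤-reflexive (sym x≡))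
                      , bound (e₂-triple-bound₂ x≡ 1≤θ (2≤M 2≤I p<q) 1≤t)
    where
    x≡ : x ≡ θ + (M + t)
    x≡ = first≡θ+[M+t] p<q
    1≤θ : 1 ≤ θ
    1≤θ = n≢0⇒n>0 (λ θ≡0 → ¬A ((pos , ΣI) , w-pos (≤-trans (s≤s z≤n) 2≤x) 2≤xs , θ≡0⇒Θ⁺≡0 θ≡0))
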